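{- For any connected graph $G$ such that $D(G^c)=2$, $\operatorname{Sd}_s(G,G^c)=\beta_s(G)$.
   Context: All graphs are finite, simple and undirected; $G^c$ denotes the complement of $G$ on the same vertex set and $D(H)$ the diameter of a connected graph $H$. For a connected graph $H$, $d_H(x,y)$ is the length of a shortest $x$–$y$ path; a vertex $w$ strongly resolves $u,v$ if $d_H(u,w)=d_H(u,v)+d_H(v,w)$ or $d_H(v,w)=d_H(v,u)+d_H(u,w)$; a set $S\subseteq V(H)$ is a strong metric generator for $H$ if every two distinct vertices are strongly resolved by some vertex of $S$. For connected graphs $G_1,\dots,G_k$ on a common vertex set $V$, $\operatorname{Sd}_s(G_1,\dots,G_k)$ is the minimum cardinality of a set $S\subseteq V$ that is a strong metric generator for every $G_i$. A strong resolving cover for $H$ is a set that is both a vertex cover of $H$ (meets every edge) and a strong metric generator for $H$; $\beta_s(H)$ is the minimum cardinality of a strong resolving cover for $H$. -}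

module Defs where

open import Data.Nat using (ℕ; zero; suc; _+_; _≤_)
open import Data.Bool using (Bool; true; false; not; if_then_else_)
open import Data.Fin using (Fin; _≟_)
open import Data.Fin.Subset using (Subset; _∈_; ∣_∣)
open import Data.Product using (Σ; ∃; _×_; _,_)
open import Data.Sum using (_⊎_)
open import Relation.Nullary using (yes; no; ¬_)
open import Data.Empty using (⊥-elim)
open import Relation.Binary.PropositionalEquality using (_≡_; refl; sym)

record Graph (n : ℕ) : Set where
  field
    adj    : Fin n → Fin n → Bool
    adj-sym    : ∀ x y → adj x y ≡ adj y x
    adj-irrefl : ∀ x → adj x x ≡ false
open Graph public

compAdj : ∀ {n} → Graph n → Fin n → Fin n → Bool
compAdj G x y with x ≟ y
... | yes _ = false
... | no  _ = not (adj G x y)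

compSym : ∀ {n} (G : Graph n) x y → compAdj G x y ≡ compAdj G y x
compSym G x y with x ≟ y | y ≟ x
... | yes _ | yes _ = refl
... | yes p | no ¬q = ⊥-elim (¬q (sym p))
... | no ¬p | yes q = ⊥-elim (¬p (sym q))
... | no _  | no _  rewrite adj-sym G x y = refl

compIrrefl : ∀ {n} (G : Graph n) x → compAdj G x x ≡ false
compIrrefl G x with x ≟ x
... | yes _ = refl
... | no ¬p = ⊥-elim (¬p refl)

_ᶜ : ∀ {n} → Graph n → Graph n
G ᶜ = record { adj = compAdj G ; adj-sym = compSym G ; adj-irrefl = compIrrefl G }

data Walk {n} (G : Graph n) : Fin n → Fin n → ℕ → Set where
  here : ∀ {x} → Walk G x x zero
  step : ∀ {x y z k} → adj G x y ≡ true → Walk G y z k → Walk G x z (suc k)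

Dist : ∀ {n} → Graph n → Fin n → Fin n → ℕ → Set
Dist G x y k = Walk G x y k × (∀ m → Walk G x y m → k ≤ m)

Connected : ∀ {n} → Graph n → Set
Connected G = ∀ x y → ∃ λ k → Walk G x y k

HasDiameter : ∀ {n} → Graph n → ℕ → Set
HasDiameter G d =
  (∀ x y k → Dist G x y k → k ≤ d) × (∃ λ x → ∃ λ y → Dist G x y d)

StronglyResolves : ∀ {n} → Graph n → Fin n → Fin n → Fin n → Set
StronglyResolves G w u v =
  (Σ ℕ λ a → Σ ℕ λ b → Σ ℕ λ c →
     Dist G u w a × Dist G u v b × Dist G v w c × a ≡ b + c)
  ⊎
  (Σ ℕ λ a → Σ ℕ λ b → Σ ℕ λ c →
     Dist G v w a × Dist G v u b × Dist G u w c × a ≡ b + c)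

IsStrongMetricGenerator : ∀ {n} → Graph n → Subset n → Set
IsStrongMetricGenerator G S =
  ∀ u v → ¬ (u ≡ v) → ∃ λ w → w ∈ S × StronglyResolves G w u v

IsVertexCover : ∀ {n} → Graph n → Subset n → Set
IsVertexCover G S = ∀ x y → adj G x y ≡ true → x ∈ S ⊎ y ∈ S

IsStrongResolvingCover : ∀ {n} → Graph n → Subset n → Set
IsStrongResolvingCover G S = IsVertexCover G S × IsStrongMetricGenerator G S

IsMinCard : ∀ {n} → (Subset n → Set) → ℕ → Set
IsMinCard {n} P k = (∃ λ S → P S × ∣ S ∣ ≡ k) × (∀ S → P S → k ≤ ∣ S ∣)

IsSimultStrongDim : ∀ {n} → Graph n → Graph n → ℕ → Set
IsSimultStrongDim G₁ G₂ = IsMinCard (λ S → IsStrongMetricGenerator G₁ S × IsStrongMetricGenerator G₂ S)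

IsBetaS : ∀ {n} → Graph n → ℕ → Set
IsBetaS G = IsMinCard (IsStrongResolvingCover G)

-- When D(Gᶜ) = 2, distances in Gᶜ are 1 on non-edges of G and 2 on edges of G.
-- A vertex strongly resolving an edge uv of G in Gᶜ must then be u or v, so a
-- strong metric generator of Gᶜ is a vertex cover of G. Conversely let S be a
-- strong resolving cover of G and u, v distinct and non-adjacent in G. If w ∈ S
-- resolves them in G with v on a u–w geodesic, then either v ∈ S, or the next
-- vertex v' of a v–w geodesic lies in S (it covers the edge vv'); in the latter
-- case d_G(u,v') > d_G(u,v) ≥ 1, so in Gᶜ we get d(v,v') = 2 = d(v,u) + d(u,v').
-- Hence the two minimisation problems have the same feasible sets.
module Submission where

open import Defs
open import Data.Nat using (ℕ; zero; suc; _+_; _≤_; z≤n; s≤s)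
open import Data.Nat.Properties
  using ( _≟_; ≤-antisym; ≤-trans; n≤0⇒n≡0; n≢0⇒n>0
        ; +-suc; +-identityʳ; +-cancelˡ-≤; +-cancelʳ-≤ )
open Data.Nat.Properties.≤-Reasoning
import Data.Bool as Bool
open import Data.Bool using (true; false)
open import Data.Fin using (Fin) renaming (_≟_ to _≟ᶠ_)
open import Data.Fin.Subset using (Subset; _∈_; ∣_∣; ⊤)
open import Data.Fin.Subset.Properties using (_∈?_; ∈⊤; anySubset?)
open import Data.Fin.Properties using (any?; all?)
open import Data.Product using (Σ; ∃; _×_; _,_; proj₁; proj₂)
open import Data.Sum using (_⊎_; inj₁; inj₂; swap)
open import Function using (_∘_)
open import Relation.Nullary using (Dec; yes; no; contradiction)
open import Relation.Nullary.Decidable using (map′; _×-dec_; _⊎-dec_; _→-dec_; ¬?)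
open import Relation.Unary using (Decidable; _≐_)
open import Relation.Binary.PropositionalEquality
  using (_≡_; _≢_; refl; sym; trans; cong; cong₂; subst)

least : ∀ {P : ℕ → Set} → Decidable P → ∀ {k} → P k → ∃ λ m → P m × (∀ j → P j → m ≤ j)
least P? p with P? 0
... | yes p₀ = 0 , p₀ , λ _ _ → z≤n
least P? {zero} p | no ¬p₀ = contradiction p ¬p₀
least P? {suc k} p | no ¬p₀ with least (P? ∘ suc) p
... | m , pm , minimal = suc m , pm , λ
  { zero    p₀ → contradiction p₀ ¬p₀
  ; (suc j) pj → s≤s (minimal j pj)
  }

minCard : ∀ {n} {P : Subset n → Set} → Decidable P → ∀ {S} → P S → ∃ (IsMinCard P)
minCard P? {S} pS with least (λ j → anySubset? (λ T → P? T ×-dec (∣ T ∣ ≟ j))) (S , pS , refl)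
... | k , attained , minimal = k , attained , λ T pT → minimal ∣ T ∣ (T , pT , refl)

IsMinCard-resp-≐ : ∀ {n} {P Q : Subset n → Set} {k} → P ≐ Q → IsMinCard P k → IsMinCard Q k
IsMinCard-resp-≐ (P⊆Q , Q⊆P) ((S , pS , card) , minimal) =
  (S , P⊆Q pS , card) , λ T qT → minimal T (Q⊆P qT)

_++ʷ_ : ∀ {n} {G : Graph n} {x y z a b} → Walk G x y a → Walk G y z b → Walk G x z (a + b)
here     ++ʷ q = q
step e p ++ʷ q = step e (p ++ʷ q)

module _ {n} (G : Graph n) where

  adj⇒≢ : ∀ {x y} → adj G x y ≡ true → x ≢ y
  adj⇒≢ {x} e refl with trans (sym (adj-irrefl G x)) e
  ... | ()

  adjᶜ-intro : ∀ {x y} → x ≢ y → adj G x y ≡ false → adj (G ᶜ) x y ≡ true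
  adjᶜ-intro {x} {y} x≢y e with x ≟ᶠ y
  ... | yes x≡y = contradiction x≡y x≢y
  ... | no _ rewrite e = refl

  adj⇒¬adjᶜ : ∀ {x y} → adj G x y ≡ true → adj (G ᶜ) x y ≢ true
  adj⇒¬adjᶜ {x} {y} e with x ≟ᶠ y
  ... | yes _ = λ ()
  ... | no _ rewrite e = λ ()

  walk? : ∀ x y k → Dec (Walk G x y k)
  walk? x y zero with x ≟ᶠ y
  ... | yes refl = yes here
  ... | no x≢y   = no λ { here → x≢y refl }
  walk? x y (suc k) =
    map′ (λ (z , e , p) → step e p) (λ { (step e p) → _ , e , p })
         (any? λ z → (adj G x z Bool.≟ true) ×-dec walk? z y k)

  vertexCover? : Decidable (IsVertexCover G)
  vertexCover? S = all? λ x → all? λ y →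
    (adj G x y Bool.≟ true) →-dec ((x ∈? S) ⊎-dec (y ∈? S))

module Distance {n} (G : Graph n) (connected : Connected G) where

  shortest : ∀ x y → Σ ℕ (Dist G x y)
  shortest x y = least (walk? G x y) (proj₂ (connected x y))

  d : Fin n → Fin n → ℕ
  d x y = proj₁ (shortest x y)

  d-Dist : ∀ x y → Dist G x y (d x y)
  d-Dist x y = proj₂ (shortest x y)

  d-walk : ∀ x y → Walk G x y (d x y)
  d-walk x y = proj₁ (d-Dist x y)

  d-≤ : ∀ {x y k} → Walk G x y k → d x y ≤ k
  d-≤ {x} {y} p = proj₂ (d-Dist x y) _ p

  Dist⇒≡d : ∀ {x y k} → Dist G x y k → k ≡ d x y
  Dist⇒≡d (p , minimal) = ≤-antisym (minimal _ (d-walk _ _)) (d-≤ p)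

  d-refl : ∀ x → d x x ≡ 0
  d-refl x = n≤0⇒n≡0 (d-≤ {x} {x} here)

  d≡0⇒≡ : ∀ {x y} → d x y ≡ 0 → x ≡ y
  d≡0⇒≡ {x} {y} e with d x y | d-walk x y
  d≡0⇒≡ refl | _ | here = refl

  d≡1⇒adj : ∀ {x y} → d x y ≡ 1 → adj G x y ≡ true
  d≡1⇒adj {x} {y} e with d x y | d-walk x y
  d≡1⇒adj refl | _ | step e here = e

  ≢⇒1≤d : ∀ {x y} → x ≢ y → 1 ≤ d x y
  ≢⇒1≤d x≢y = n≢0⇒n>0 (x≢y ∘ d≡0⇒≡)

  adj⇒d≡1 : ∀ {x y} → adj G x y ≡ true → d x y ≡ 1
  adj⇒d≡1 e = ≤-antisym (d-≤ (step e here)) (≢⇒1≤d (adj⇒≢ G e))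

  2≤d⇒≢ : ∀ {x y} → 2 ≤ d x y → x ≢ y
  2≤d⇒≢ {x} le refl with subst (2 ≤_) (d-refl x) le
  ... | ()

  2≤d⇒nonadj : ∀ {x y} → 2 ≤ d x y → adj G x y ≡ false
  2≤d⇒nonadj {x} {y} le with adj G x y in e
  ... | false = refl
  ... | true with subst (2 ≤_) (adj⇒d≡1 e) le
  ...   | s≤s ()

  triangle : ∀ x y z → d x z ≤ d x y + d y z
  triangle x y z = d-≤ (d-walk x y ++ʷ d-walk y z)

  first-step : ∀ x y → x ≡ y ⊎ ∃ λ z → adj G x z ≡ true × suc (d z y) ≡ d x y
  first-step x y with d x y | d-Dist x y
  ... | zero  | here , _ = inj₁ refl
  ... | suc k | step {y = z} e p , minimal =
    inj₂ (z , e , ≤-antisym (s≤s (d-≤ p)) (minimal _ (step e (d-walk z y))))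

  Resolvesᵈ : Fin n → Fin n → Fin n → Set
  Resolvesᵈ w u v = d u w ≡ d u v + d v w ⊎ d v w ≡ d v u + d u w

  resolves⇒resolvesᵈ : ∀ {w u v} → StronglyResolves G w u v → Resolvesᵈ w u v
  resolves⇒resolvesᵈ (inj₁ (_ , _ , _ , p , q , r , e)) = inj₁ (along p q r e)
    where
    along : ∀ {u v w a b c} → Dist G u w a → Dist G u v b → Dist G v w c →
            a ≡ b + c → d u w ≡ d u v + d v w
    along p q r e = trans (sym (Dist⇒≡d p)) (trans e (cong₂ _+_ (Dist⇒≡d q) (Dist⇒≡d r)))
  resolves⇒resolvesᵈ {w} {u} {v} (inj₂ r) = swap (resolves⇒resolvesᵈ {w} {v} {u} (inj₁ r))

  resolvesᵈ⇒resolves : ∀ {w u v} → Resolvesᵈ w u v → StronglyResolves G w u v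
  resolvesᵈ⇒resolves {w} {u} {v} (inj₁ e) =
    inj₁ (_ , _ , _ , d-Dist u w , d-Dist u v , d-Dist v w , e)
  resolvesᵈ⇒resolves {w} {u} {v} (inj₂ e) =
    inj₂ (_ , _ , _ , d-Dist v w , d-Dist v u , d-Dist u w , e)

  resolves? : ∀ w u v → Dec (StronglyResolves G w u v)
  resolves? w u v = map′ resolvesᵈ⇒resolves resolves⇒resolvesᵈ
    ((d u w ≟ d u v + d v w) ⊎-dec (d v w ≟ d v u + d u w))

  endpoint-resolvesˡ : ∀ u v → StronglyResolves G u u v
  endpoint-resolvesˡ u v = resolvesᵈ⇒resolves (inj₂ (begin-equality
    d v u          ≡⟨ sym (+-identityʳ (d v u)) ⟩
    d v u + 0      ≡⟨ cong (d v u +_) (sym (d-refl u)) ⟩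
    d v u + d u u  ∎))

  endpoint-resolvesʳ : ∀ u v → StronglyResolves G v u v
  endpoint-resolvesʳ u v = swap (endpoint-resolvesˡ v u)

  strongMetricGenerator? : Decidable (IsStrongMetricGenerator G)
  strongMetricGenerator? S = all? λ u → all? λ v → ¬? (u ≟ᶠ v) →-dec
    any? λ w → (w ∈? S) ×-dec resolves? w u v

  strongResolvingCover? : Decidable (IsStrongResolvingCover G)
  strongResolvingCover? S = vertexCover? G S ×-dec strongMetricGenerator? S

  ⊤-strongResolvingCover : IsStrongResolvingCover G ⊤
  ⊤-strongResolvingCover = (λ _ _ _ → inj₁ ∈⊤) , λ u v _ → u , ∈⊤ , endpoint-resolvesˡ u v

module DiameterTwoComplement {n} (G : Graph n)
  (connectedᶜ : Connected (G ᶜ)) (diameter : HasDiameter (G ᶜ) 2) where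

  module Dᶜ = Distance (G ᶜ) connectedᶜ
  open Dᶜ using () renaming (d to dᶜ)

  dᶜ-nonadj : ∀ {x y} → x ≢ y → adj G x y ≡ false → dᶜ x y ≡ 1
  dᶜ-nonadj {x} {y} x≢y e = Dᶜ.adj⇒d≡1 {x} {y} (adjᶜ-intro G x≢y e)

  dᶜ-adj : ∀ {x y} → adj G x y ≡ true → dᶜ x y ≡ 2
  dᶜ-adj {x} {y} e with dᶜ x y in eq | proj₁ diameter x y _ (Dᶜ.d-Dist x y)
  ... | 0 | _ = contradiction (Dᶜ.d≡0⇒≡ {x} {y} eq) (adj⇒≢ G e)
  ... | 1 | _ = contradiction (Dᶜ.d≡1⇒adj {x} {y} eq) (adj⇒¬adjᶜ G e)
  ... | 2 | _ = refl
  ... | suc (suc (suc _)) | s≤s (s≤s ())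

  resolvesᶜ-edge⇒endpoint : ∀ {u v w} → adj G u v ≡ true → dᶜ u w ≡ dᶜ u v + dᶜ v w → v ≡ w
  resolvesᶜ-edge⇒endpoint {u} {v} {w} e eq = Dᶜ.d≡0⇒≡ (n≤0⇒n≡0 (+-cancelˡ-≤ 2 _ 0 beyond))
    where
    beyond : 2 + dᶜ v w ≤ 2
    beyond = begin
      2 + dᶜ v w       ≡⟨ cong (_+ dᶜ v w) (sym (dᶜ-adj e)) ⟩
      dᶜ u v + dᶜ v w  ≡⟨ sym eq ⟩
      dᶜ u w           ≤⟨ proj₁ diameter u w _ (Dᶜ.d-Dist u w) ⟩
      2                ∎

  smgᶜ⇒vertexCover : ∀ {S} → IsStrongMetricGenerator (G ᶜ) S → IsVertexCover G S
  smgᶜ⇒vertexCover {S} smg u v e with smg u v (adj⇒≢ G e)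
  ... | w , w∈S , r with Dᶜ.resolves⇒resolvesᵈ r
  ...   | inj₁ eq = inj₂ (subst (_∈ S) (sym (resolvesᶜ-edge⇒endpoint e eq)) w∈S)
  ...   | inj₂ eq =
    inj₁ (subst (_∈ S) (sym (resolvesᶜ-edge⇒endpoint (trans (adj-sym G v u) e) eq)) w∈S)

  module _ (connected : Connected G) where

    module D = Distance G connected

    resolvedᶜ-near-geodesic : ∀ {S u v w} → IsVertexCover G S → u ≢ v → adj G u v ≡ false →
      w ∈ S → D.d u w ≡ D.d u v + D.d v w → ∃ λ w' → w' ∈ S × StronglyResolves (G ᶜ) w' u v
    resolvedᶜ-near-geodesic {_} {u} {v} {w} cover u≢v nonadj w∈S onGeodesic with D.first-step v w
    ... | inj₁ refl = v , w∈S , Dᶜ.endpoint-resolvesʳ u v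
    ... | inj₂ (v' , e , next) with cover v v' e
    ...   | inj₁ v∈S  = v , v∈S , Dᶜ.endpoint-resolvesʳ u v
    ...   | inj₂ v'∈S = v' , v'∈S , Dᶜ.resolvesᵈ⇒resolves (inj₂ (begin-equality
      dᶜ v v'           ≡⟨ dᶜ-adj e ⟩
      1 + 1             ≡⟨ cong₂ _+_ (sym dᶜ-vu) (sym dᶜ-uv') ⟩
      dᶜ v u + dᶜ u v'  ∎))
      where
      dᶜ-vu : dᶜ v u ≡ 1
      dᶜ-vu = dᶜ-nonadj (u≢v ∘ sym) (trans (adj-sym G v u) nonadj)
      beyond : suc (D.d u v) + D.d v' w ≤ D.d u v' + D.d v' w
      beyond = begin
        suc (D.d u v) + D.d v' w  ≡⟨ sym (+-suc (D.d u v) (D.d v' w)) ⟩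
        D.d u v + suc (D.d v' w)  ≡⟨ cong (D.d u v +_) next ⟩
        D.d u v + D.d v w         ≡⟨ sym onGeodesic ⟩
        D.d u w                   ≤⟨ D.triangle u v' w ⟩
        D.d u v' + D.d v' w       ∎
      u-far-v' : 2 ≤ D.d u v'
      u-far-v' = ≤-trans (s≤s (D.≢⇒1≤d u≢v)) (+-cancelʳ-≤ (D.d v' w) _ _ beyond)
      dᶜ-uv' : dᶜ u v' ≡ 1
      dᶜ-uv' = dᶜ-nonadj (D.2≤d⇒≢ {u} {v'} u-far-v') (D.2≤d⇒nonadj {u} {v'} u-far-v')

    strongResolvingCover⇒smgᶜ : ∀ {S} → IsStrongResolvingCover G S →
                                IsStrongMetricGenerator (G ᶜ) S
    strongResolvingCover⇒smgᶜ (cover , smg) u v u≢v with adj G u v in e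
    ... | true with cover u v e
    ...   | inj₁ u∈S = u , u∈S , Dᶜ.endpoint-resolvesˡ u v
    ...   | inj₂ v∈S = v , v∈S , Dᶜ.endpoint-resolvesʳ u v
    strongResolvingCover⇒smgᶜ (cover , smg) u v u≢v | false with smg u v u≢v
    ... | w , w∈S , r with D.resolves⇒resolvesᵈ r
    ...   | inj₁ eq = resolvedᶜ-near-geodesic cover u≢v e w∈S eq
    ...   | inj₂ eq with resolvedᶜ-near-geodesic cover (u≢v ∘ sym) (trans (adj-sym G v u) e) w∈S eq
    ...     | w' , w'∈S , r' = w' , w'∈S , swap r'

    strongResolvingCover≐simultaneous :
      IsStrongResolvingCover G ≐ (λ S → IsStrongMetricGenerator G S × IsStrongMetricGenerator (G ᶜ) S)
    strongResolvingCover≐simultaneous =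
      (λ cover → proj₂ cover , strongResolvingCover⇒smgᶜ cover) ,
      (λ (smg , smgᶜ) → smgᶜ⇒vertexCover smgᶜ , smg)

mainTheorem15 : ∀ {n} (G : Graph n) → Connected G → Connected (G ᶜ) → HasDiameter (G ᶜ) 2 →
    Σ ℕ λ k → IsSimultStrongDim G (G ᶜ) k × IsBetaS G k
mainTheorem15 G connected connectedᶜ diameter =
  let k , minimalCover = minCard strongResolvingCover? ⊤-strongResolvingCover
  in k , IsMinCard-resp-≐ (strongResolvingCover≐simultaneous connected) minimalCover , minimalCover
  where
  open Distance G connected
  open DiameterTwoComplement G connectedᶜ diameter
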